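{- Let $E$ be a 2-polygraph, with $0$-generators $E_0$, $1$-generators $E_1$ and $2$-generators $E_2$, generating the free 2-category $E^*$. Let $F$ be the 3-polygraph defined by $F_0=E_0$; $F_1=\{f^n \mid f\in E_1,\ n\in\mathbb{Z}\}$, where for $f:A\to B$ the 1-generator $f^n$ has type $A\to B$ if $n$ is even and $B\to A$ if $n$ is odd; $F_2=\{\alpha^0\mid \alpha\in E_2\}\uplus\{\eta_{f^n},\varepsilon_{f^n}\mid f^n\in F_1\}$, where $\alpha^0:f_1^0\otimes\cdots\otimes f_k^0\Rightarrow g_1^0\otimes\cdots\otimes g_l^0$ whenever $\alpha:f_1\otimes\cdots\otimes f_k\Rightarrow g_1\otimes\cdots\otimes g_l$ with $f_i,g_j\in E_1$, and, for $f^n:A\to B$, $\eta_{f^n}:\mathrm{id}_B\Rightarrow f^{n-1}\otimes f^n$ and $\varepsilon_{f^n}:f^n\otimes f^{n-1}\Rightarrow \mathrm{id}_A$; and $F_3=\{l_{f^n},r_{f^n}\mid f^n\in F_1\}$ with $l_{f^n}:(f^{n-1}\otimes\varepsilon_{f^n})\circ(\eta_{f^n}\otimes f^{n-1})\Rrightarrow f^{n-1}$ and $r_{f^n}:(\varepsilon_{f^n}\otimes f^n)\circ(f^n\otimes\eta_{f^n})\Rrightarrow f^n$ (the targets being identity 2-cells). For a 1-cell $f=a_1\otimes\cdots\otimes a_k$ of $E^*$ (with $a_i\in E_1$), write $f^0=a_1^0\otimes\cdots\otimes a_k^0$. Let $f_1,\ldots,f_m$ and $g_1,\ldots,g_n$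 be lists of composable 1-cells of $E^*$ such that $f_1\otimes\cdots\otimes f_m$ and $g_1\otimes\cdots\otimes g_n$ are parallel. Then every 2-cell $\alpha: f_1^0\otimes\cdots\otimes f_m^0\Rightarrow g_1^0\otimes\cdots\otimes g_n^0$ in the 2-category freely generated by the underlying 2-polygraph of $F$ which is a normal form with respect to the rewriting rules $F_3$ contains no 2-generator of the form $\eta_{f^k}$ or $\varepsilon_{f^k}$.
   Context: An $n$-polygraph (higher-dimensional rewriting system) consists of sets $E_0,\ldots,E_n$ of generators where each $(k+1)$-generator has as source and target parallel $k$-cells of the free $k$-category generated by the generators of dimension $\le k$; it generates a free $n$-category $E^*$. In a 2-category, $\otimes$ denotes horizontal composition (written in diagrammatic order, so for $f:A\to B$, $g:B\to C$, $f\otimes g:A\to C$) and $\circ$ denotes vertical composition of 2-cells; a 1-cell written inside a composite of 2-cells stands for its identity 2-cell. A 3-polygraph is viewed as a rewriting system on 2-cells: a 2-cell one-step rewrites to another when it is obtained by placing the source of a 3-generator in a context (composing and tensoring with other 2-cells) and replacing it by the target; a normal form is a 2-cell to which no rule applies. -}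

module Defs where

open import Data.Integer using (ℤ; _-_; 0ℤ; 1ℤ)
open import Data.Product using (Σ; _×_; _,_; ∃)
open import Data.Sum using (_⊎_)
open import Data.Unit using (⊤)
open import Relation.Nullary using (¬_)
open import Relation.Binary.PropositionalEquality using (_≡_; refl; sym)
open import Relation.Binary.Construct.Closure.ReflexiveTransitive
  using (Star; ε; _◅_; _◅◅_; gmap; concat)
open import Relation.Binary.Construct.Closure.ReflexiveTransitive.Properties
  using (◅◅-assoc)

record Polygraph2 : Set₁ where
  field
    E₀ : Set
    E₁ : E₀ → E₀ → Set
    E₂ : {A B : E₀} → Star E₁ A B → Star E₁ A B → Set

-- The free 2-category generated by a 2-polygraph, presented concretely:
-- a 2-cell is a finite sequence of whiskered 2-generators u ⊗ g ⊗ v,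
-- taken up to the equivalence generated by the exchange law (and
-- irrelevance of the typing proofs).  Sequences are written in
-- diagrammatic order: (x ◅ y ◅ ε) is "first x, then y", i.e. y ∘ x.

module Free2Cat {O : Set} (G₁ : O → O → Set)
                (G₂ : {A B : O} → Star G₁ A B → Star G₁ A B → Set) where

  Path : O → O → Set
  Path = Star G₁

  data Step {A B : O} (p q : Path A B) : Set where
    whisk : ∀ {C D} (u : Path A C) {s t : Path C D} (g : G₂ s t) (v : Path D B) →
            p ≡ u ◅◅ (s ◅◅ v) → q ≡ u ◅◅ (t ◅◅ v) → Step p q

  Cell : {A B : O} → Path A B → Path A B → Set
  Cell = Star Step

  data Exch {A B : O} {p m₁ m₂ q : Path A B} :
            Step p m₁ → Step m₁ q → Step p m₂ → Step m₂ q → Set where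
    exch : ∀ {C D E F} (u : Path A C) {s₁ t₁ : Path C D} (g₁ : G₂ s₁ t₁)
             (m : Path D E) {s₂ t₂ : Path E F} (g₂ : G₂ s₂ t₂) (v : Path F B)
             e₁ e₂ e₃ e₄ e₅ e₆ e₇ e₈ →
           Exch (whisk u g₁ (m ◅◅ (s₂ ◅◅ v)) e₁ e₂)
                (whisk (u ◅◅ (t₁ ◅◅ m)) g₂ v e₃ e₄)
                (whisk (u ◅◅ (s₁ ◅◅ m)) g₂ v e₅ e₆)
                (whisk u g₁ (m ◅◅ (t₂ ◅◅ v)) e₇ e₈)

  infix 4 _≈_
  data _≈_ {A B : O} : {p q : Path A B} → Cell p q → Cell p q → Set where
    ≈-refl  : ∀ {p q} {c : Cell p q} → c ≈ c
    ≈-sym   : ∀ {p q} {c d : Cell p q} → c ≈ d → d ≈ c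
    ≈-trans : ∀ {p q} {c d e : Cell p q} → c ≈ d → d ≈ e → c ≈ e
    ≈-exch  : ∀ {p q r w m₁ m₂}
                {x : Step p m₁} {y : Step m₁ q} {x' : Step p m₂} {y' : Step m₂ q} →
              Exch x y x' y' → (γ : Cell r p) (δ : Cell q w) →
              γ ◅◅ (x ◅ y ◅ ε) ◅◅ δ ≈ γ ◅◅ (x' ◅ y' ◅ ε) ◅◅ δ
    ≈-irr   : ∀ {p q r w C D} (u : Path A C) {s t : Path C D} (g : G₂ s t)
                (v : Path D B) e₁ e₂ e₃ e₄ (γ : Cell r p) (δ : Cell q w) →
              γ ◅◅ (whisk u g v e₁ e₂ ◅ ε) ◅◅ δ ≈ γ ◅◅ (whisk u g v e₃ e₄ ◅ ε) ◅◅ δ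

  data Contains (P : ∀ {C D} {s t : Path C D} → G₂ s t → Set) {A B : O} :
                {p q : Path A B} → Cell p q → Set where
    here  : ∀ {p q r C D} (u : Path A C) {s t : Path C D} {g : G₂ s t} (v : Path D B)
              e₁ e₂ (c : Cell q r) → P g → Contains P (whisk {p = p} {q = q} u g v e₁ e₂ ◅ c)
    there : ∀ {p q r} (x : Step p q) {c : Cell q r} → Contains P c → Contains P (x ◅ c)

module Construction (E : Polygraph2) where
  open Polygraph2 E

  -- 1-generators f^n of F.  For f : X → Y in E₁ we write
  --   ev f k = f^(2k)   : X → Y
  --   od f k = f^(2k+1) : Y → X
  -- so that {f^n | n ∈ ℤ} is {ev f k | k ∈ ℤ} ⊎ {od f k | k ∈ ℤ}.
  data F₁ : E₀ → E₀ → Set where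
    ev : ∀ {X Y} → E₁ X Y → ℤ → F₁ X Y
    od : ∀ {X Y} → E₁ X Y → ℤ → F₁ Y X

  -- f^n ↦ f^(n-1)
  prev : ∀ {A B} → F₁ A B → F₁ B A
  prev (ev f k) = od f (k - 1ℤ)
  prev (od f k) = ev f k

  expo : ∀ {A B} → F₁ A B → ℤ
  expo (ev f k) = k Data.Integer.+ k
  expo (od f k) = (k Data.Integer.+ k) Data.Integer.+ 1ℤ

  zero-lift : ∀ {A B} → Star E₁ A B → Star F₁ A B
  zero-lift = gmap (λ X → X) (λ f → ev f 0ℤ)

  [_] : ∀ {A B} → F₁ A B → Star F₁ A B
  [ φ ] = φ ◅ ε

  data F₂ : {A B : E₀} → Star F₁ A B → Star F₁ A B → Set where
    lift : ∀ {A B} {s t : Star E₁ A B} → E₂ s t → F₂ (zero-lift s) (zero-lift t)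
    η    : ∀ {A B} (φ : F₁ A B) → F₂ {B} {B} ε (prev φ ◅ φ ◅ ε)
    ϵ    : ∀ {A B} (φ : F₁ A B) → F₂ {A} {A} (φ ◅ prev φ ◅ ε) ε

  data IsUnitOrCounit : ∀ {A B} {s t : Star F₁ A B} → F₂ s t → Set where
    is-η : ∀ {A B} (φ : F₁ A B) → IsUnitOrCounit (η φ)
    is-ϵ : ∀ {A B} (φ : F₁ A B) → IsUnitOrCounit (ϵ φ)

  open Free2Cat F₁ F₂ public

  private
    a3 : ∀ {A C D B} (u : Path A C) (x : Path C D) (v : Path D B) →
         u ◅◅ (x ◅◅ v) ≡ (u ◅◅ x) ◅◅ v
    a3 u x v = sym (◅◅-assoc u x v)

  l-src : ∀ {A X Y B} (u : Path A Y) (φ : F₁ X Y) (v : Path X B) →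
          Cell (u ◅◅ ([ prev φ ] ◅◅ v)) (u ◅◅ ([ prev φ ] ◅◅ v))
  l-src u φ v =
    whisk u (η φ) ([ prev φ ] ◅◅ v) refl refl ◅
    whisk (u ◅◅ [ prev φ ]) (ϵ φ) v (a3 u [ prev φ ] _) (a3 u [ prev φ ] v) ◅ ε

  r-src : ∀ {A X Y B} (u : Path A X) (φ : F₁ X Y) (v : Path Y B) →
          Cell (u ◅◅ ([ φ ] ◅◅ v)) (u ◅◅ ([ φ ] ◅◅ v))
  r-src u φ v =
    whisk (u ◅◅ [ φ ]) (η φ) v (a3 u [ φ ] v) (a3 u [ φ ] _) ◅
    whisk u (ϵ φ) ([ φ ] ◅◅ v) refl refl ◅ ε

  -- one-step rewriting by F₃ in context γ ∘ (u ⊗ _ ⊗ v) ∘ δ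
  -- (targets of l_φ, r_φ are identity 2-cells, so the reduct is γ then δ)
  data _⇛_ {A B : E₀} {p q : Path A B} : Cell p q → Cell p q → Set where
    by-l : ∀ {X Y} (u : Path A Y) (φ : F₁ X Y) (v : Path X B)
             (γ : Cell p (u ◅◅ ([ prev φ ] ◅◅ v))) (δ : Cell (u ◅◅ ([ prev φ ] ◅◅ v)) q)
             {α β : Cell p q} →
           α ≈ γ ◅◅ l-src u φ v ◅◅ δ → β ≈ γ ◅◅ δ → α ⇛ β
    by-r : ∀ {X Y} (u : Path A X) (φ : F₁ X Y) (v : Path Y B)
             (γ : Cell p (u ◅◅ ([ φ ] ◅◅ v))) (δ : Cell (u ◅◅ ([ φ ] ◅◅ v)) q)
             {α β : Cell p q} →
           α ≈ γ ◅◅ r-src u φ v ◅◅ δ → β ≈ γ ◅◅ δ → α ⇛ β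

  IsNormalForm : ∀ {A B} {p q : Path A B} → Cell p q → Set
  IsNormalForm α = ∀ β → ¬ (α ⇛ β)

  tensor0 : ∀ {A B} → Star (Star E₁) A B → Path A B
  tensor0 fs = concat (gmap (λ X → X) zero-lift fs)

-- Weigh a wire f^n by |n|.  If α : f^0 ⇒ g^0 contains an ε, that ε consumes a wire of nonzero
-- exponent, which some η created; so α contains an η, and we take one, η_φ, whose outputs f^{n-1} ⊗ f^n
-- reach the largest weight D ≥ 1 of any η in α.  Then no wire of α ever weighs more than D.  The output of
-- weight D (f^n if n ≥ 1, f^{n-1} if n ≤ 0) cannot survive to the target, where all exponents are 0, and
-- since pairing it the other way would need a wire of weight D + 1, the ε that consumes it pairs it with
-- its neighbour on the side away from the η's other output.  The steps on that side commute to before the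
-- η, the steps on the other side to after the ε, and what is left in the middle is the source of l_φ or
-- r_φ: α is reducible.

module Submission where

open import Defs
open import Axiom.UniquenessOfIdentityProofs.WithK using (uip)
open import Data.Empty using (⊥-elim)
open import Data.Sum using (inj₁; inj₂)
open import Data.Integer as ℤ using (+_; -[1+_]; 0ℤ; 1ℤ; ∣_∣)
open import Data.Integer.Tactic.RingSolver using (solve-∀)
open import Data.Nat as ℕ using (ℕ; zero; suc; _≤_; _<_; _⊔_; z≤n; s≤s)
open import Data.Nat.Properties as ℕ
  using (≤-refl; ≤-trans; <⇒≱; m≤n⊔m; ⊔-lub; m⊔n≤o⇒m≤o; m⊔n≤o⇒n≤o)
open import Data.Product using (Σ; _×_; _,_; proj₂; uncurry)
open import Data.Star.Decoration using (All; ↦; mapAll; _◅◅◅_)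
open import Relation.Binary.Bundles using (Setoid)
import Relation.Binary.Reasoning.Setoid as SetoidReasoning
open import Relation.Nullary using (¬_; yes; no)
open import Relation.Binary.PropositionalEquality
open import Relation.Binary.Construct.Closure.ReflexiveTransitive
  using (Star; ε; _◅_; _◅◅_)
open import Relation.Binary.Construct.Closure.ReflexiveTransitive.Properties
  using (◅◅-assoc)

≤⊔∧<⇒≤ʳ : ∀ {m n o} → o ≤ m ⊔ n → m < o → o ≤ n
≤⊔∧<⇒≤ʳ {m} {n} h m<o with ℕ.⊔-sel m n
... | inj₁ m⊔n≡m = ⊥-elim (<⇒≱ m<o (subst (_ ≤_) m⊔n≡m h))
... | inj₂ m⊔n≡n = subst (_ ≤_) m⊔n≡n h

-[1+]-pred : ∀ n → -[1+ n ] ℤ.- 1ℤ ≡ -[1+ suc n ]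
-[1+]-pred n = cong (λ z → -[1+ suc z ]) (ℕ.+-identityʳ n)

pred≡+suc⇒suc<∣∣ : ∀ z {n} → z ℤ.- 1ℤ ≡ + suc n → suc n < ∣ z ∣
pred≡+suc⇒suc<∣∣ (+ suc _) refl = ≤-refl
pred≡+suc⇒suc<∣∣ -[1+ k ] e with trans (sym (-[1+]-pred k)) e
... | ()

1≤adjacent-weights : ∀ z → 1 ≤ ∣ z ℤ.- 1ℤ ∣ ⊔ ∣ z ∣
1≤adjacent-weights (+ zero)  = s≤s z≤n
1≤adjacent-weights (+ suc n) = ≤-trans (s≤s z≤n) (m≤n⊔m n (suc n))
1≤adjacent-weights -[1+ n ]  = s≤s z≤n

module _ {O : Set} {T : O → O → Set} where

  ◅◅-identityʳ : ∀ {A B} (xs : Star T A B) → xs ◅◅ ε ≡ xs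
  ◅◅-identityʳ ε        = refl
  ◅◅-identityʳ (x ◅ xs) = cong (x ◅_) (◅◅-identityʳ xs)

  ◅◅-assoc₄ : ∀ {A B C D F} (ws : Star T A B) (xs : Star T B C) (ys : Star T C D) (zs : Star T D F) →
              (ws ◅◅ (xs ◅◅ ys)) ◅◅ zs ≡ ws ◅◅ (xs ◅◅ (ys ◅◅ zs))
  ◅◅-assoc₄ ws xs ys zs = trans (◅◅-assoc ws (xs ◅◅ ys) zs) (cong (ws ◅◅_) (◅◅-assoc xs ys zs))

  data SameHead {A B C} (x : T A C) (xs : Star T C B) : ∀ {D} → T A D → Star T D B → Set where
    same-head : ∀ {ys} → xs ≡ ys → SameHead x xs x ys

  ◅-injective : ∀ {A B C D} {x : T A C} {y : T A D} {xs : Star T C B} {ys : Star T D B} →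
                _≡_ {A = Star T A B} (x ◅ xs) (y ◅ ys) → SameHead x xs y ys
  ◅-injective refl = same-head refl

  data Factorisations {A B C D} (xs : Star T A C) (ys : Star T C B)
                      (zs : Star T A D) (ws : Star T D B) : Set where
    xs-prefix : (m : Star T C D) → zs ≡ xs ◅◅ m → ys ≡ m ◅◅ ws → Factorisations xs ys zs ws
    zs-strict-prefix : ∀ {Z} (h : T D Z) (m : Star T Z C) →
                       xs ≡ zs ◅◅ (h ◅ m) → ws ≡ (h ◅ m) ◅◅ ys → Factorisations xs ys zs ws

  factorisations : ∀ {A B C D} (xs : Star T A C) (ys : Star T C B) (zs : Star T A D) (ws : Star T D B) →
                   xs ◅◅ ys ≡ zs ◅◅ ws → Factorisations xs ys zs ws
  factorisations ε        ys zs       ws eq = xs-prefix zs refl eq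
  factorisations (x ◅ xs) ys ε        ws eq = zs-strict-prefix x xs refl (sym eq)
  factorisations (x ◅ xs) ys (z ◅ zs) ws eq with ◅-injective eq
  ... | same-head eq′ with factorisations xs ys zs ws eq′
  ...   | xs-prefix m e₁ e₂           = xs-prefix m (cong (x ◅_) e₁) e₂
  ...   | zs-strict-prefix h m e₁ e₂ = zs-strict-prefix h m (cong (x ◅_) e₁) e₂

module _ {O : Set} {T : O → O → Set} {P : ∀ {X Y} → T X Y → Set} where

  All-++⁻ˡ : ∀ {A B C} (xs : Star T A B) {ys : Star T B C} → All P (xs ◅◅ ys) → All P xs
  All-++⁻ˡ ε        _           = ε
  All-++⁻ˡ (x ◅ xs) (↦ p ◅ ps) = ↦ p ◅ All-++⁻ˡ xs ps

  All-++⁻ʳ : ∀ {A B C} (xs : Star T A B) {ys : Star T B C} → All P (xs ◅◅ ys) → All P ys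
  All-++⁻ʳ ε        ps          = ps
  All-++⁻ʳ (x ◅ xs) (↦ p ◅ ps) = All-++⁻ʳ xs ps

  All-at : ∀ {A B X Y} {p : Star T A B} (xs : Star T A X) (w : T X Y) (ys : Star T Y B) →
           p ≡ xs ◅◅ (w ◅ ys) → All P p → P w
  All-at xs w ys refl ps with All-++⁻ʳ xs ps
  ... | ↦ p ◅ _ = p

module Free2CatProperties {O : Set} (G₁ : O → O → Set)
                          (G₂ : {A B : O} → Star G₁ A B → Star G₁ A B → Set) where
  open Free2Cat G₁ G₂

  ≡⇒≈ : ∀ {A B} {p q : Path A B} {c d : Cell p q} → c ≡ d → c ≈ d
  ≡⇒≈ refl = ≈-refl

  ◅◅-congʳ : ∀ {A B} {p q r : Path A B} {c d : Cell p q} (δ : Cell q r) → c ≈ d → c ◅◅ δ ≈ d ◅◅ δ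
  ◅◅-congʳ δ ≈-refl        = ≈-refl
  ◅◅-congʳ δ (≈-sym h)     = ≈-sym (◅◅-congʳ δ h)
  ◅◅-congʳ δ (≈-trans h k) = ≈-trans (◅◅-congʳ δ h) (◅◅-congʳ δ k)
  ◅◅-congʳ δ (≈-exch {x = x} {y} {x′} {y′} X γ δ₀) =
    ≈-trans (≡⇒≈ (◅◅-assoc γ (x ◅ y ◅ δ₀) δ))
      (≈-trans (≈-exch X γ (δ₀ ◅◅ δ)) (≡⇒≈ (sym (◅◅-assoc γ (x′ ◅ y′ ◅ δ₀) δ))))
  ◅◅-congʳ δ (≈-irr u g v e₁ e₂ e₃ e₄ γ δ₀) =
    ≈-trans (≡⇒≈ (◅◅-assoc γ _ δ))
      (≈-trans (≈-irr u g v e₁ e₂ e₃ e₄ γ (δ₀ ◅◅ δ)) (≡⇒≈ (sym (◅◅-assoc γ _ δ))))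

  ◅◅-congˡ : ∀ {A B} {o p q : Path A B} (γ : Cell o p) {c d : Cell p q} → c ≈ d → γ ◅◅ c ≈ γ ◅◅ d
  ◅◅-congˡ γ ≈-refl        = ≈-refl
  ◅◅-congˡ γ (≈-sym h)     = ≈-sym (◅◅-congˡ γ h)
  ◅◅-congˡ γ (≈-trans h k) = ≈-trans (◅◅-congˡ γ h) (◅◅-congˡ γ k)
  ◅◅-congˡ γ (≈-exch {x = x} {y} {x′} {y′} X γ₀ δ₀) =
    ≈-trans (≡⇒≈ (sym (◅◅-assoc γ γ₀ (x ◅ y ◅ δ₀))))
      (≈-trans (≈-exch X (γ ◅◅ γ₀) δ₀) (≡⇒≈ (◅◅-assoc γ γ₀ (x′ ◅ y′ ◅ δ₀))))
  ◅◅-congˡ γ (≈-irr u g v e₁ e₂ e₃ e₄ γ₀ δ₀) =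
    ≈-trans (≡⇒≈ (sym (◅◅-assoc γ γ₀ _)))
      (≈-trans (≈-irr u g v e₁ e₂ e₃ e₄ (γ ◅◅ γ₀) δ₀) (≡⇒≈ (◅◅-assoc γ γ₀ _)))

  whisk-cong : ∀ {A B C D} {p q : Path A B} {u u′ : Path A C} {s t : Path C D} (g : G₂ s t)
               {v v′ : Path D B} (eu : u ≡ u′) (ev : v ≡ v′) e₁ e₂ e₁′ e₂′ →
               whisk {p = p} {q = q} u g v e₁ e₂ ≡ whisk u′ g v′ e₁′ e₂′
  whisk-cong g refl refl e₁ e₂ e₁′ e₂′ = cong₂ (whisk _ g _) (uip e₁ e₁′) (uip e₂ e₂′)

  -- Below, kᵢ names a proof used as the i-th boundary equation eᵢ of an exchange.
  exchange : ∀ {A B C D F H} {p m₁ m₂ q : Path A B} (u : Path A C) {s₁ t₁ : Path C D} (g₁ : G₂ s₁ t₁)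
             (m : Path D F) {s₂ t₂ : Path F H} (g₂ : G₂ s₂ t₂) (v : Path H B) e₁ e₂ e₃ e₄ e₅ e₆ e₇ e₈ →
             _≈_ {p = p} {q = q}
               (whisk {q = m₁} u g₁ (m ◅◅ (s₂ ◅◅ v)) e₁ e₂ ◅ whisk (u ◅◅ (t₁ ◅◅ m)) g₂ v e₃ e₄ ◅ ε)
               (whisk {q = m₂} (u ◅◅ (s₁ ◅◅ m)) g₂ v e₅ e₆ ◅ whisk u g₁ (m ◅◅ (t₂ ◅◅ v)) e₇ e₈ ◅ ε)
  exchange u g₁ m g₂ v e₁ e₂ e₃ e₄ e₅ e₆ e₇ e₈ = ≈-exch (exch u g₁ m g₂ v e₁ e₂ e₃ e₄ e₅ e₆ e₇ e₈) ε ε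

  -- LeftOf b a a′ c : c rewrites the boundary a ◅◅ b into a′ ◅◅ b, each step acting inside the prefix.
  data LeftOf {A B Y} (b : Path Y B) : {p q : Path A B} → Path A Y → Path A Y → Cell p q → Set where
    lnil  : ∀ {p a} → LeftOf b {p} {p} a a ε
    lcons : ∀ {p m q C D} {s t : Path C D} (u : Path A C) (g : G₂ s t) (w : Path D Y) (v : Path D B)
              {a a′} e₁ e₂ {c : Cell m q} → a ≡ u ◅◅ (s ◅◅ w) → v ≡ w ◅◅ b →
            LeftOf b (u ◅◅ (t ◅◅ w)) a′ c → LeftOf b a a′ (whisk {p = p} {q = m} u g v e₁ e₂ ◅ c)

  data RightOf {A B X} (a : Path A X) : {p q : Path A B} → Path X B → Path X B → Cell p q → Set where
    rnil  : ∀ {p b} → RightOf a {p} {p} b b ε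
    rcons : ∀ {p m q C D} {s t : Path C D} (u : Path A C) (w : Path X C) (g : G₂ s t) (v : Path D B)
              {b b′} e₁ e₂ {c : Cell m q} → u ≡ a ◅◅ w → b ≡ w ◅◅ (s ◅◅ v) →
            RightOf a (w ◅◅ (t ◅◅ v)) b′ c → RightOf a b b′ (whisk {p = p} {q = m} u g v e₁ e₂ ◅ c)

  LeftOf-snoc : ∀ {A B Y} {b : Path Y B} {a a′ : Path A Y} {p q r : Path A B} {c : Cell p q} →
    LeftOf b a a′ c →
    ∀ {C D} (u : Path A C) {s t : Path C D} (g : G₂ s t) (w : Path D Y) (v : Path D B) e₁ e₂ →
    a′ ≡ u ◅◅ (s ◅◅ w) → v ≡ w ◅◅ b →
    LeftOf b a (u ◅◅ (t ◅◅ w)) (c ◅◅ (whisk {p = q} {q = r} u g v e₁ e₂ ◅ ε))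
  LeftOf-snoc lnil                           u g w v e₁ e₂ ea ev = lcons u g w v e₁ e₂ ea ev lnil
  LeftOf-snoc (lcons u₁ g₁ w₁ v₁ f₁ f₂ ea₁ ev₁ L) u g w v e₁ e₂ ea ev =
    lcons u₁ g₁ w₁ v₁ f₁ f₂ ea₁ ev₁ (LeftOf-snoc L u g w v e₁ e₂ ea ev)

  RightOf-snoc : ∀ {A B X} {a : Path A X} {b b′ : Path X B} {p q r : Path A B} {c : Cell p q} →
    RightOf a b b′ c →
    ∀ {C D} (u : Path A C) (w : Path X C) {s t : Path C D} (g : G₂ s t) (v : Path D B) e₁ e₂ →
    u ≡ a ◅◅ w → b′ ≡ w ◅◅ (s ◅◅ v) →
    RightOf a b (w ◅◅ (t ◅◅ v)) (c ◅◅ (whisk {p = q} {q = r} u g v e₁ e₂ ◅ ε))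
  RightOf-snoc rnil                           u w g v e₁ e₂ eu eb = rcons u w g v e₁ e₂ eu eb rnil
  RightOf-snoc (rcons u₁ w₁ g₁ v₁ f₁ f₂ eu₁ eb₁ R) u w g v e₁ e₂ eu eb =
    rcons u₁ w₁ g₁ v₁ f₁ f₂ eu₁ eb₁ (RightOf-snoc R u w g v e₁ e₂ eu eb)

  LeftOf-commute : ∀ {A B Y} {b : Path Y B} {a a′ : Path A Y} {p q r : Path A B} {c : Cell p q} →
    LeftOf b a a′ c →
    ∀ {C D} (u : Path A C) (m : Path Y C) {s t : Path C D} (g : G₂ s t) (v : Path D B) e₁ e₂ →
    u ≡ a′ ◅◅ m → b ≡ m ◅◅ (s ◅◅ v) →
    Σ (Path A B) λ p′ → Σ (Cell p′ r) λ c′ →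
    Σ (p ≡ (a ◅◅ m) ◅◅ (s ◅◅ v)) λ e₁′ → Σ (p′ ≡ (a ◅◅ m) ◅◅ (t ◅◅ v)) λ e₂′ →
      LeftOf (m ◅◅ (t ◅◅ v)) a a′ c′ ×
      c ◅◅ (whisk {p = q} {q = r} u g v e₁ e₂ ◅ ε) ≈ whisk (a ◅◅ m) g v e₁′ e₂′ ◅ c′
  LeftOf-commute lnil u m g v e₁ e₂ refl refl = _ , ε , e₁ , e₂ , lnil , ≈-refl
  LeftOf-commute (lcons {s = s₁} {t = t₁} u₁ g₁ w₁ v₁ f₁ f₂ {c = c₀} refl refl L)
                 u m {s} {t} g v e₁ e₂ refl refl
    with LeftOf-commute L u m g v e₁ e₂ refl refl
  ... | _ , c₀′ , h₁ , h₂ , L′ , h =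
    _ , (x₁′ ◅ c₀′) , h₁′ , h₂′ , lcons u₁ g₁ w₁ (w ◅◅ (t ◅◅ v)) k₇ k₈ refl (◅◅-assoc w₁ m (t ◅◅ v)) L′ ,
    ≈-trans (◅◅-congˡ (x₁ ◅ ε) h)
      (≈-trans (≡⇒≈ (cong₂ (λ y z → y ◅ z ◅ c₀′) x₁≡ x≡))
        (≈-trans (◅◅-congʳ c₀′ (exchange u₁ g₁ w g v k₁ k₂ k₃ k₄ k₅ refl k₇ k₈))
          (≡⇒≈ (cong (λ y → y ◅ x₁′ ◅ c₀′) x′≡))))
    where
      w = w₁ ◅◅ m
      x₁ = whisk u₁ g₁ (w₁ ◅◅ (m ◅◅ (s ◅◅ v))) f₁ f₂
      reassoc : ∀ {z} → (u₁ ◅◅ (z ◅◅ w₁)) ◅◅ m ≡ u₁ ◅◅ (z ◅◅ w)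
      reassoc {z} = ◅◅-assoc₄ u₁ z w₁ m
      k₁ = trans f₁ (cong (λ z → u₁ ◅◅ (s₁ ◅◅ z)) (sym (◅◅-assoc w₁ m (s ◅◅ v))))
      k₂ = trans f₂ (cong (λ z → u₁ ◅◅ (t₁ ◅◅ z)) (sym (◅◅-assoc w₁ m (s ◅◅ v))))
      k₃ = trans h₁ (cong (_◅◅ (s ◅◅ v)) reassoc)
      k₄ = trans h₂ (cong (_◅◅ (t ◅◅ v)) reassoc)
      k₅ = trans k₁ (sym (◅◅-assoc₄ u₁ s₁ w (s ◅◅ v)))
      k₇ = ◅◅-assoc₄ u₁ s₁ w (t ◅◅ v)
      k₈ = trans k₄ (◅◅-assoc₄ u₁ t₁ w (t ◅◅ v))
      h₁′ = trans k₅ (cong (_◅◅ (s ◅◅ v)) (sym reassoc))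
      h₂′ = cong (_◅◅ (t ◅◅ v)) (sym reassoc)
      x₁′ = whisk u₁ g₁ (w ◅◅ (t ◅◅ v)) k₇ k₈
      x₁≡ = whisk-cong g₁ refl (sym (◅◅-assoc w₁ m (s ◅◅ v))) f₁ f₂ k₁ k₂
      x≡ = whisk-cong g reassoc refl h₁ h₂ k₃ k₄
      x′≡ = whisk-cong g (sym reassoc) refl k₅ refl h₁′ h₂′

  RightOf-commute : ∀ {A B X} {a : Path A X} {b b′ : Path X B} {p q r : Path A B} {c : Cell p q} →
    RightOf a b b′ c →
    ∀ {C D} (u : Path A C) (m : Path D X) {s t : Path C D} (g : G₂ s t) (v : Path D B) e₁ e₂ →
    a ≡ u ◅◅ (s ◅◅ m) → v ≡ m ◅◅ b′ →
    Σ (Path A B) λ p′ → Σ (Cell p′ r) λ c′ →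
    Σ (p ≡ u ◅◅ (s ◅◅ (m ◅◅ b))) λ e₁′ → Σ (p′ ≡ u ◅◅ (t ◅◅ (m ◅◅ b))) λ e₂′ →
      RightOf (u ◅◅ (t ◅◅ m)) b b′ c′ ×
      c ◅◅ (whisk {p = q} {q = r} u g v e₁ e₂ ◅ ε) ≈ whisk u g (m ◅◅ b) e₁′ e₂′ ◅ c′
  RightOf-commute rnil u m g v e₁ e₂ refl refl = _ , ε , e₁ , e₂ , rnil , ≈-refl
  RightOf-commute (rcons {s = s₁} {t = t₁} u₁ w₁ g₁ v₁ f₁ f₂ {c = c₀} refl refl R)
                  u m {s} {t} g v e₁ e₂ refl refl
    with RightOf-commute R u m g v e₁ e₂ refl refl
  ... | _ , c₀′ , h₁ , h₂ , R′ , h =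
    _ , (x₁′ ◅ c₀′) , h₁′ , h₂′ , rcons (u ◅◅ (t ◅◅ w)) w₁ g₁ v₁ k₃ k₄ (sym (◅◅-assoc₄ u t m w₁)) refl R′ ,
    ≈-trans (◅◅-congˡ (x₁ ◅ ε) h)
      (≈-trans (≡⇒≈ (cong₂ (λ y z → y ◅ z ◅ c₀′) x₁≡ x≡))
        (≈-trans (◅◅-congʳ c₀′ (≈-sym (exchange u g w g₁ v₁ k₁ refl k₃ k₄ k₅ k₆ k₇ k₈)))
          (≡⇒≈ (cong (λ y → y ◅ x₁′ ◅ c₀′) x′≡))))
    where
      w = m ◅◅ w₁
      x₁ = whisk ((u ◅◅ (s ◅◅ m)) ◅◅ w₁) g₁ v₁ f₁ f₂
      reassoc = ◅◅-assoc₄ u s m w₁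
      k₅ = trans f₁ (cong (_◅◅ (s₁ ◅◅ v₁)) reassoc)
      k₆ = trans f₂ (cong (_◅◅ (t₁ ◅◅ v₁)) reassoc)
      unassoc = sym (◅◅-assoc m w₁ (t₁ ◅◅ v₁))
      k₇ = trans h₁ (cong (λ z → u ◅◅ (s ◅◅ z)) unassoc)
      k₈ = trans h₂ (cong (λ z → u ◅◅ (t ◅◅ z)) unassoc)
      k₁ = trans k₅ (◅◅-assoc₄ u s w (s₁ ◅◅ v₁))
      k₃ = sym (◅◅-assoc₄ u t w (s₁ ◅◅ v₁))
      k₄ = trans k₈ (sym (◅◅-assoc₄ u t w (t₁ ◅◅ v₁)))
      h₁′ = trans k₁ (cong (λ z → u ◅◅ (s ◅◅ z)) (◅◅-assoc m w₁ (s₁ ◅◅ v₁)))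
      h₂′ = cong (λ z → u ◅◅ (t ◅◅ z)) (◅◅-assoc m w₁ (s₁ ◅◅ v₁))
      x₁′ = whisk (u ◅◅ (t ◅◅ w)) g₁ v₁ k₃ k₄
      x₁≡ = whisk-cong g₁ reassoc refl f₁ f₂ k₅ k₆
      x≡ = whisk-cong g refl unassoc h₁ h₂ k₇ k₈
      x′≡ = whisk-cong g refl (◅◅-assoc m w₁ (s₁ ◅◅ v₁)) k₁ refl h₁′ h₂′

  data WireView {A B X Y} (w : G₁ X Y) (a : Path A X) (b : Path Y B) {p q : Path A B} : Step p q → Set where
    left  : ∀ {C D} (u : Path A C) {s t : Path C D} (g : G₂ s t) (m : Path D X) e₁ e₂ →
            a ≡ u ◅◅ (s ◅◅ m) → WireView w a b (whisk u g (m ◅◅ (w ◅ b)) e₁ e₂)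
    right : ∀ {C D} (m : Path Y C) {s t : Path C D} (g : G₂ s t) (v : Path D B) e₁ e₂ →
            b ≡ m ◅◅ (s ◅◅ v) → WireView w a b (whisk (a ◅◅ (w ◅ m)) g v e₁ e₂)
    touch : ∀ {C D} (u : Path A C) {s t : Path C D} (g : G₂ s t) (v : Path D B)
              (s₁ : Path C X) (s₂ : Path Y D) e₁ e₂ →
            a ≡ u ◅◅ s₁ → s ≡ s₁ ◅◅ (w ◅ s₂) → b ≡ s₂ ◅◅ v → WireView w a b (whisk u g v e₁ e₂)

  wireView : ∀ {A B X Y} (w : G₁ X Y) (a : Path A X) (b : Path Y B) {p q : Path A B}
             (x : Step p q) → p ≡ a ◅◅ (w ◅ b) → WireView w a b x
  wireView w a b (whisk u {s} g v e₁ e₂) eq with factorisations u (s ◅◅ v) a (w ◅ b) (trans (sym e₁) eq)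
  ... | zs-strict-prefix h m refl e with ◅-injective e
  ...   | same-head e′ = right m g v e₁ e₂ e′
  wireView w a b (whisk u {s} g v e₁ e₂) eq | xs-prefix m₁ ea e with factorisations s v m₁ (w ◅ b) e
  ... | xs-prefix m₂ refl refl = left u g m₂ e₁ e₂ ea
  ... | zs-strict-prefix h m₃ es e′ with ◅-injective e′
  ...   | same-head e″ = touch u g v m₁ m₃ e₁ e₂ ea es e″

  Cell-setoid : ∀ {A B} (p q : Path A B) → Setoid _ _
  Cell-setoid p q = record
    { Carrier = Cell p q
    ; _≈_ = _≈_
    ; isEquivalence = record { refl = ≈-refl ; sym = ≈-sym ; trans = ≈-trans }
    }

  module ≈-Reasoning {A B} {p q : Path A B} = SetoidReasoning (Cell-setoid p q)

  Up-to-≈ : ∀ {A B} {p q : Path A B} → (Cell p q → Set) → Cell p q → Set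
  Up-to-≈ P c = Σ _ λ c′ → c ≈ c′ × P c′

module NormalForms (E : Polygraph2) where
  open Polygraph2 E
  open Construction E
  open Free2CatProperties F₁ F₂

  next : ∀ {A B} → F₁ B A → F₁ A B
  next (ev f k) = od f k
  next (od f k) = ev f (k ℤ.+ 1ℤ)

  next-prev : ∀ {A B} (φ : F₁ A B) → next (prev φ) ≡ φ
  next-prev (ev f k) = cong (ev f) (lemma k)
    where lemma : ∀ k → (k ℤ.- 1ℤ) ℤ.+ 1ℤ ≡ k
          lemma = solve-∀
  next-prev (od f k) = refl

  prev-injective : ∀ {A B} {ψ φ : F₁ A B} → prev ψ ≡ prev φ → ψ ≡ φ
  prev-injective {ψ = ψ} {φ} eq = trans (sym (next-prev ψ)) (trans (cong next eq) (next-prev φ))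

  expo-prev : ∀ {A B} (φ : F₁ A B) → expo (prev φ) ≡ expo φ ℤ.- 1ℤ
  expo-prev (ev f k) = lemma k
    where lemma : ∀ k → ((k ℤ.- 1ℤ) ℤ.+ (k ℤ.- 1ℤ)) ℤ.+ 1ℤ ≡ (k ℤ.+ k) ℤ.- 1ℤ
          lemma = solve-∀
  expo-prev (od f k) = lemma k
    where lemma : ∀ k → k ℤ.+ k ≡ ((k ℤ.+ k) ℤ.+ 1ℤ) ℤ.- 1ℤ
          lemma = solve-∀

  weight : ∀ {A B} → F₁ A B → ℕ
  weight φ = ∣ expo φ ∣

  Bounded : ℕ → ∀ {A B} → Path A B → Set
  Bounded D = All (λ φ → weight φ ≤ D)

  Flat : ∀ {A B} → Path A B → Set
  Flat = All (λ φ → expo φ ≡ 0ℤ)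

  Flat⇒Bounded : ∀ {D A B} {p : Path A B} → Flat p → Bounded D p
  Flat⇒Bounded {D} = mapAll (λ e → subst (λ z → ∣ z ∣ ≤ D) (sym e) z≤n)

  Bounded-infix : ∀ {D A B C C′} {p : Path A B} (u : Path A C) (s : Path C C′) (v : Path C′ B) →
                  p ≡ u ◅◅ (s ◅◅ v) → Bounded D p → Bounded D s
  Bounded-infix u s v refl bp = All-++⁻ˡ s (All-++⁻ʳ u bp)

  zero-lift-flat : ∀ {A B} (s : Star E₁ A B) → Flat (zero-lift s)
  zero-lift-flat ε       = ε
  zero-lift-flat (f ◅ s) = ↦ refl ◅ zero-lift-flat s

  tensor0-flat : ∀ {A B} (fs : Star (Star E₁) A B) → Flat (tensor0 fs)
  tensor0-flat ε        = ε
  tensor0-flat (f ◅ fs) = zero-lift-flat f ◅◅◅ tensor0-flat fs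

  -- the largest weight of a wire a generator creates; lift creates only wires of weight 0
  degree : ∀ {C D} {s t : Path C D} → F₂ s t → ℕ
  degree (lift _) = 0
  degree (η φ)    = weight (prev φ) ⊔ weight φ
  degree (ϵ _)    = 0

  stepDegree : ∀ {A B} {p q : Path A B} → Step p q → ℕ
  stepDegree (whisk _ g _ _ _) = degree g

  maxDegree : ∀ {A B} {p q : Path A B} → Cell p q → ℕ
  maxDegree ε       = 0
  maxDegree (x ◅ c) = stepDegree x ⊔ maxDegree c

  target-bounded : ∀ {D C C′} {s t : Path C C′} (g : F₂ s t) → degree g ≤ D → Bounded D t
  target-bounded (lift {t = t} _) _ = Flat⇒Bounded (zero-lift-flat t)
  target-bounded (η φ)            h = ↦ (m⊔n≤o⇒m≤o _ _ h) ◅ ↦ (m⊔n≤o⇒n≤o _ _ h) ◅ ε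
  target-bounded (ϵ _)            _ = ε

  step-bounded : ∀ {D A B} {p q : Path A B} (x : Step p q) → Bounded D p → stepDegree x ≤ D → Bounded D q
  step-bounded (whisk u {s} g v refl refl) bp h =
    All-++⁻ˡ u bp ◅◅◅ (target-bounded g h ◅◅◅ All-++⁻ʳ s (All-++⁻ʳ u bp))

  Within : ℕ → ∀ {A B} {p q : Path A B} → Cell p q → Set
  Within D {p = p} c = Bounded D p × maxDegree c ≤ D

  Within-step : ∀ {D A B} {p q r : Path A B} (x : Step p q) (c : Cell q r) → Within D (x ◅ c) → Within D c
  Within-step x c (bp , h) = step-bounded x bp (m⊔n≤o⇒m≤o _ _ h) , m⊔n≤o⇒n≤o _ _ h

  1≤degree-η : ∀ {X Y} (φ : F₁ X Y) → 1 ≤ degree (η φ)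
  1≤degree-η φ = subst (λ z → 1 ≤ ∣ z ∣ ⊔ weight φ) (sym (expo-prev φ)) (1≤adjacent-weights (expo φ))

  degree-η-≡ : ∀ {X Y} (φ : F₁ X Y) {y z} → expo (prev φ) ≡ y → expo φ ≡ z → degree (η φ) ≡ ∣ y ∣ ⊔ ∣ z ∣
  degree-η-≡ φ = cong₂ (λ y z → ∣ y ∣ ⊔ ∣ z ∣)

  data HeavierWire {X Y} (φ : F₁ X Y) : Set where
    right-wire : ∀ n → expo φ ≡ + suc n → degree (η φ) ≡ suc n → HeavierWire φ
    left-wire  : ∀ k → expo (prev φ) ≡ -[1+ k ] → degree (η φ) ≡ suc k → HeavierWire φ

  heavier-wire : ∀ {X Y} (φ : F₁ X Y) → HeavierWire φ
  heavier-wire φ with expo φ in eφ | expo-prev φ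
  ... | + suc n  | ep = right-wire n eφ (trans (degree-η-≡ φ ep eφ) (ℕ.m≤n⇒m⊔n≡n (ℕ.n≤1+n n)))
  ... | + zero   | ep = left-wire 0 ep (degree-η-≡ φ ep eφ)
  ... | -[1+ n ] | ep = left-wire (suc n) ep′ (trans (degree-η-≡ φ ep′ eφ) (ℕ.m≥n⇒m⊔n≡m (ℕ.n≤1+n _)))
    where ep′ = trans ep (-[1+]-pred n)

  ε≢◅◅◅ : ∀ {C X Y} (s₁ : Path C X) (w : F₁ X Y) (s₂ : Path Y C) → ¬ ε ≡ s₁ ◅◅ (w ◅ s₂)
  ε≢◅◅◅ ε       w s₂ ()
  ε≢◅◅◅ (_ ◅ _) w s₂ ()

  data LeftCapOf {X Y} (φ : F₁ X Y) : ∀ {C D} {s t : Path C D} → F₂ s t → Path C X → Path Y D → Set where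
    ϵ-left : LeftCapOf φ (ϵ φ) ε (prev φ ◅ ε)

  data RightCapOf {X Y} (φ : F₁ X Y) : ∀ {C D} {s t : Path C D} → F₂ s t → Path C Y → Path X D → Set where
    ϵ-right : RightCapOf φ (ϵ φ) (φ ◅ ε) ε

  -- φ cannot be the right input of an ϵ: the left input would weigh more than the bound.
  positive-heaviest-capped : ∀ {X Y} (φ : F₁ X Y) {n} → expo φ ≡ + suc n →
    ∀ {C D} {s t : Path C D} (g : F₂ s t) (s₁ : Path C X) (s₂ : Path Y D) →
    s ≡ s₁ ◅◅ (φ ◅ s₂) → Bounded (suc n) s → LeftCapOf φ g s₁ s₂
  positive-heaviest-capped φ eφ (lift {s = s} _) s₁ s₂ es _
    with trans (sym eφ) (All-at s₁ φ s₂ es (zero-lift-flat s))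
  ... | ()
  positive-heaviest-capped φ eφ (η _) s₁ s₂ es _ = ⊥-elim (ε≢◅◅◅ s₁ φ s₂ es)
  positive-heaviest-capped φ eφ (ϵ _) ε s₂ refl _ = ϵ-left
  positive-heaviest-capped φ eφ (ϵ ψ) (_ ◅ ε) s₂ refl (↦ ψ≤ ◅ _) =
    ⊥-elim (<⇒≱ (pred≡+suc⇒suc<∣∣ (expo ψ) (trans (sym (expo-prev ψ)) eφ)) ψ≤)
  positive-heaviest-capped φ eφ (ϵ _) (_ ◅ _ ◅ s₁) s₂ es _ with ◅-injective es
  ... | same-head e with ◅-injective e
  ...   | same-head e′ = ⊥-elim (ε≢◅◅◅ s₁ φ s₂ e′)

  negative-heaviest-capped : ∀ {X Y} (φ : F₁ X Y) {w : F₁ Y X} → w ≡ prev φ → ∀ {k} → expo w ≡ -[1+ k ] →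
    ∀ {C D} {s t : Path C D} (g : F₂ s t) (s₁ : Path C Y) (s₂ : Path X D) →
    s ≡ s₁ ◅◅ (w ◅ s₂) → Bounded (suc k) s → RightCapOf φ g s₁ s₂
  negative-heaviest-capped φ {w} ew ew- (lift {s = s} _) s₁ s₂ es _
    with trans (sym ew-) (All-at s₁ w s₂ es (zero-lift-flat s))
  ... | ()
  negative-heaviest-capped φ {w} ew ew- (η _) s₁ s₂ es _ = ⊥-elim (ε≢◅◅◅ s₁ w s₂ es)
  negative-heaviest-capped φ {w} ew {k} ew- (ϵ _) ε s₂ refl (↦ _ ◅ ↦ prev-w≤ ◅ _) =
    ⊥-elim (ℕ.1+n≰n (subst (λ z → ∣ z ∣ ≤ suc k) prev-w-expo prev-w≤))
    where prev-w-expo = trans (expo-prev w) (trans (cong (ℤ._- 1ℤ) ew-) (-[1+]-pred k))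
  negative-heaviest-capped φ ew ew- (ϵ ψ) (_ ◅ ε) s₂ refl _ with prev-injective {ψ = ψ} {φ} ew
  ... | refl = ϵ-right
  negative-heaviest-capped φ {w} ew ew- (ϵ _) (_ ◅ _ ◅ s₁) s₂ es _ with ◅-injective es
  ... | same-head e with ◅-injective e
  ...   | same-head e′ = ⊥-elim (ε≢◅◅◅ s₁ w s₂ e′)

  Reducible : ∀ {A B} {p q : Path A B} → Cell p q → Set
  Reducible α = Σ _ (α ⇛_)

  Reducible-resp : ∀ {A B} {p q : Path A B} {α α′ : Cell p q} → α ≈ α′ → Reducible α′ → Reducible α
  Reducible-resp h (β , by-l u φ v γ δ e₁ e₂) = β , by-l u φ v γ δ (≈-trans h e₁) e₂
  Reducible-resp h (β , by-r u φ v γ δ e₁ e₂) = β , by-r u φ v γ δ (≈-trans h e₁) e₂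

  Reducible-extend : ∀ {A B} {S p q r : Path A B} {c : Cell S p} {x : Step p q} {c′ : Cell S q} →
                     c ◅◅ (x ◅ ε) ≈ c′ → (rest : Cell q r) →
                     Reducible (c′ ◅◅ rest) → Reducible (c ◅◅ (x ◅ rest))
  Reducible-extend {c = c} {x} h rest =
    Reducible-resp (≈-trans (≡⇒≈ (sym (◅◅-assoc c (x ◅ ε) rest))) (◅◅-congʳ rest h))

  zigzagˡ-reducible : ∀ {A B} {S p₀ p₁ p₂ Q : Path A B} (G : Cell S p₀) {X Y} (φ : F₁ X Y)
    (u : Path A Y) (v : Path Y B) e₁ e₂ (u′ : Path A X) (v′ : Path X B) e₃ e₄ (δ : Cell p₂ Q) →
    u′ ≡ u ◅◅ (prev φ ◅ ε) → v ≡ prev φ ◅ v′ →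
    Reducible (G ◅◅ (whisk {q = p₁} u (η φ) v e₁ e₂ ◅ whisk u′ (ϵ φ) v′ e₃ e₄ ◅ δ))
  zigzagˡ-reducible G φ u v e₁ e₂ u′ v′ e₃ e₄ δ refl refl =
    reduce e₁ e₂ e₃ e₄ δ (trans e₄ (◅◅-assoc u (prev φ ◅ ε) v′))
    where
      reduce : ∀ {S p₀ p₁ p₂ Q} {G : Cell S p₀} e₁ e₂ e₃ e₄ (δ : Cell p₂ Q) → p₂ ≡ u ◅◅ (prev φ ◅ v′) →
               Reducible (G ◅◅ (whisk {q = p₁} u (η φ) (prev φ ◅ v′) e₁ e₂ ◅
                                whisk (u ◅◅ (prev φ ◅ ε)) (ϵ φ) v′ e₃ e₄ ◅ δ))
      reduce {G = G} refl refl e₃ e₄ δ refl =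
        G ◅◅ δ ,
        by-l u φ v′ G δ
          (≡⇒≈ (cong (λ y → G ◅◅ (whisk u (η φ) (prev φ ◅ v′) refl refl ◅ y ◅ δ))
                     (whisk-cong (ϵ φ) refl refl e₃ e₄ _ _)))
          ≈-refl

  zigzagʳ-reducible : ∀ {A B} {S p₀ p₁ p₂ Q : Path A B} (G : Cell S p₀) {X Y} (φ : F₁ X Y)
    (u : Path A Y) (v : Path Y B) e₁ e₂ (u′ : Path A X) (v′ : Path X B) e₃ e₄ (δ : Cell p₂ Q) →
    u ≡ u′ ◅◅ (φ ◅ ε) → v′ ≡ φ ◅ v →
    Reducible (G ◅◅ (whisk {q = p₁} u (η φ) v e₁ e₂ ◅ whisk u′ (ϵ φ) v′ e₃ e₄ ◅ δ))
  zigzagʳ-reducible G φ u v e₁ e₂ u′ v′ e₃ e₄ δ refl refl =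
    reduce e₁ e₂ e₃ e₄ δ (trans e₁ (◅◅-assoc u′ (φ ◅ ε) v))
    where
      reduce : ∀ {S p₀ p₁ p₂ Q} {G : Cell S p₀} e₁ e₂ e₃ e₄ (δ : Cell p₂ Q) → p₀ ≡ u′ ◅◅ (φ ◅ v) →
               Reducible (G ◅◅ (whisk {q = p₁} (u′ ◅◅ (φ ◅ ε)) (η φ) v e₁ e₂ ◅
                                whisk u′ (ϵ φ) (φ ◅ v) e₃ e₄ ◅ δ))
      reduce {G = G} e₁ e₂ refl refl δ refl =
        G ◅◅ δ ,
        by-r u′ φ v G δ
          (≡⇒≈ (cong (λ y → G ◅◅ (y ◅ whisk u′ (ϵ φ) (φ ◅ v) refl refl ◅ δ))
                     (whisk-cong (η φ) refl refl e₁ e₂ _ _)))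
          ≈-refl

  -- G ∘ (u ⊗ η_φ ⊗ b) ∘ L where L has acted only to the left of the wire φ created by the η, turning
  -- u ◅◅ [prev φ] into a; steps to the right of φ have been moved before the η, into G.
  data Trace⁺ {A B} {S : Path A B} {X Y} (φ : F₁ X Y) (a : Path A X) (b : Path Y B) {p : Path A B} :
              Cell S p → Set where
    trace⁺ : ∀ {p₀ p₁} (G : Cell S p₀) (u : Path A Y) e₁ e₂ {L : Cell p₁ p} →
             LeftOf (φ ◅ b) (u ◅◅ (prev φ ◅ ε)) a L → p ≡ a ◅◅ (φ ◅ b) →
             Trace⁺ φ a b (G ◅◅ (whisk u (η φ) b e₁ e₂ ◅ L))

  Trace⁺-boundary : ∀ {A B} {S p : Path A B} {X Y} {φ : F₁ X Y} {a b} {c : Cell S p} →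
                    Trace⁺ φ a b c → p ≡ a ◅◅ (φ ◅ b)
  Trace⁺-boundary (trace⁺ _ _ _ _ _ eq) = eq

  Trace⁺-start : ∀ {A B} {S p₀ p₁ : Path A B} (G : Cell S p₀) {X Y} (φ : F₁ X Y) (u : Path A Y) (v : Path Y B)
                 e₁ e₂ → Trace⁺ φ (u ◅◅ (prev φ ◅ ε)) v (G ◅◅ (whisk {q = p₁} u (η φ) v e₁ e₂ ◅ ε))
  Trace⁺-start G φ u v e₁ e₂ = trace⁺ G u e₁ e₂ lnil (trans e₂ (sym (◅◅-assoc u (prev φ ◅ ε) (φ ◅ v))))

  Trace⁺-left : ∀ {A B} {S p r : Path A B} {X Y} {φ : F₁ X Y} {a b} {c : Cell S p} → Trace⁺ φ a b c →
    ∀ {C D} (u : Path A C) {s t : Path C D} (g : F₂ s t) (m : Path D X) f₁ f₂ → a ≡ u ◅◅ (s ◅◅ m) →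
    Up-to-≈ (Trace⁺ φ (u ◅◅ (t ◅◅ m)) b) (c ◅◅ (whisk {q = r} u g (m ◅◅ (φ ◅ b)) f₁ f₂ ◅ ε))
  Trace⁺-left {φ = φ} {b = b} (trace⁺ G u₀ e₁ e₂ {L} lo _) u {t = t} g m f₁ f₂ ea =
    _ , ≡⇒≈ (◅◅-assoc G (whisk u₀ (η φ) b e₁ e₂ ◅ L) (whisk u g (m ◅◅ (φ ◅ b)) f₁ f₂ ◅ ε)) ,
    trace⁺ G u₀ e₁ e₂ (LeftOf-snoc lo u g m _ f₁ f₂ ea refl) (trans f₂ (sym (◅◅-assoc₄ u t m (φ ◅ b))))

  Trace⁺-right : ∀ {A B} {S p r : Path A B} {X Y} {φ : F₁ X Y} {a b} {c : Cell S p} → Trace⁺ φ a b c →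
    ∀ {C D} (m : Path Y C) {s t : Path C D} (g : F₂ s t) (v : Path D B) f₁ f₂ → b ≡ m ◅◅ (s ◅◅ v) →
    Up-to-≈ (Trace⁺ φ a (m ◅◅ (t ◅◅ v))) (c ◅◅ (whisk {q = r} (a ◅◅ (φ ◅ m)) g v f₁ f₂ ◅ ε))
  Trace⁺-right {φ = φ} {a} (trace⁺ G u e₁ e₂ {L} lo _) m {s} {t} g v f₁ f₂ refl
    with LeftOf-commute lo (a ◅◅ (φ ◅ m)) (φ ◅ m) g v f₁ f₂ refl refl
  ... | _ , L′ , h₁ , h₂ , lo′ , h =
    _ , equation , trace⁺ (G ◅◅ (x′ ◅ ε)) u k₇ k₈ lo′ (trans f₂ (◅◅-assoc a (φ ◅ m) (t ◅◅ v)))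
    where
      open ≈-Reasoning
      reassoc = ◅◅-assoc u (prev φ ◅ ε) (φ ◅ m)
      k₃ = trans h₁ (cong (_◅◅ (s ◅◅ v)) reassoc)
      k₄ = trans h₂ (cong (_◅◅ (t ◅◅ v)) reassoc)
      k₅ = trans e₁ (sym (◅◅-assoc u m (s ◅◅ v)))
      k₇ = ◅◅-assoc u m (t ◅◅ v)
      k₈ = trans k₄ (◅◅-assoc₄ u (prev φ ◅ φ ◅ ε) m (t ◅◅ v))
      cup = whisk u (η φ) (m ◅◅ (s ◅◅ v)) e₁ e₂
      cup′ = whisk u (η φ) (m ◅◅ (t ◅◅ v)) k₇ k₈
      x = whisk (a ◅◅ (φ ◅ m)) g v f₁ f₂
      x₀ = whisk ((u ◅◅ (prev φ ◅ ε)) ◅◅ (φ ◅ m)) g v h₁ h₂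
      x₃ = whisk (u ◅◅ (prev φ ◅ φ ◅ m)) g v k₃ k₄
      x′ = whisk (u ◅◅ m) g v k₅ refl
      equation = begin
        (G ◅◅ (cup ◅ L)) ◅◅ (x ◅ ε)     ≡⟨ ◅◅-assoc G (cup ◅ L) (x ◅ ε) ⟩
        G ◅◅ (cup ◅ (L ◅◅ (x ◅ ε)))     ≈⟨ ◅◅-congˡ G (◅◅-congˡ (cup ◅ ε) h) ⟩
        G ◅◅ (cup ◅ x₀ ◅ L′)            ≡⟨ cong (λ y → G ◅◅ (cup ◅ y ◅ L′)) (whisk-cong g reassoc refl h₁ h₂ k₃ k₄) ⟩
        G ◅◅ (cup ◅ x₃ ◅ L′)            ≈⟨ ◅◅-congˡ G (◅◅-congʳ L′ (exchange u (η φ) m g v e₁ e₂ k₃ k₄ k₅ refl k₇ k₈)) ⟩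
        G ◅◅ (x′ ◅ cup′ ◅ L′)           ≡⟨ sym (◅◅-assoc G (x′ ◅ ε) (cup′ ◅ L′)) ⟩
        (G ◅◅ (x′ ◅ ε)) ◅◅ (cup′ ◅ L′)  ∎

  Trace⁺-capped : ∀ {A B} {S p r Q : Path A B} {X Y} {φ : F₁ X Y} {a b} {c : Cell S p} → Trace⁺ φ a b c →
    ∀ (u : Path A X) (v : Path X B) f₁ f₂ → a ≡ u → b ≡ prev φ ◅ v → (rest : Cell r Q) →
    Reducible (c ◅◅ (whisk u (ϵ φ) v f₁ f₂ ◅ rest))
  Trace⁺-capped {φ = φ} {b = b} (trace⁺ G u₀ e₁ e₂ {L} lo _) u v f₁ f₂ refl eb rest
    with LeftOf-commute lo u ε (ϵ φ) v f₁ f₂ (sym (◅◅-identityʳ u)) (cong (φ ◅_) eb)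
  ... | _ , L′ , h₁ , h₂ , _ , h =
    Reducible-resp equation
      (zigzagˡ-reducible G φ u₀ b e₁ e₂ _ v h₁ h₂ (L′ ◅◅ rest) (◅◅-identityʳ _) eb)
    where
      open ≈-Reasoning
      cup = whisk u₀ (η φ) b e₁ e₂
      cap = whisk u (ϵ φ) v f₁ f₂
      cap′ = whisk ((u₀ ◅◅ (prev φ ◅ ε)) ◅◅ ε) (ϵ φ) v h₁ h₂
      equation = begin
        (G ◅◅ (cup ◅ L)) ◅◅ (cap ◅ rest)      ≡⟨ ◅◅-assoc G (cup ◅ L) (cap ◅ rest) ⟩
        G ◅◅ (cup ◅ (L ◅◅ (cap ◅ rest)))      ≡⟨ cong (λ y → G ◅◅ (cup ◅ y)) (sym (◅◅-assoc L (cap ◅ ε) rest)) ⟩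
        G ◅◅ (cup ◅ ((L ◅◅ (cap ◅ ε)) ◅◅ rest)) ≈⟨ ◅◅-congˡ G (◅◅-congˡ (cup ◅ ε) (◅◅-congʳ rest h)) ⟩
        G ◅◅ (cup ◅ cap′ ◅ (L′ ◅◅ rest))      ∎

  walk⁺ : ∀ {A B} {S p Q : Path A B} {X Y} (φ : F₁ X Y) {n} → expo φ ≡ + suc n →
          ∀ {a b} {c : Cell S p} → Trace⁺ φ a b c →
          (rest : Cell p Q) → Within (suc n) rest → Flat Q → Reducible (c ◅◅ rest)
  walk⁺ φ eφ {a} {b} tr ε _ flat with trans (sym eφ) (All-at a φ b (Trace⁺-boundary tr) flat)
  ... | ()
  walk⁺ φ eφ {a} {b} tr (whisk u {s} g v f₁ f₂ ◅ rest) within flat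
    with wireView φ a b (whisk u g v f₁ f₂) (Trace⁺-boundary tr)
  ... | left _ _ m _ _ ea with Trace⁺-left tr u g m f₁ f₂ ea
  ...   | _ , h , tr′ =
    Reducible-extend h rest (walk⁺ φ eφ tr′ rest (Within-step (whisk u g v f₁ f₂) rest within) flat)
  walk⁺ φ eφ {a} {b} tr (whisk u {s} g v f₁ f₂ ◅ rest) within flat
    | right m _ _ _ _ eb with Trace⁺-right tr m g v f₁ f₂ eb
  ...   | _ , h , tr′ =
    Reducible-extend h rest (walk⁺ φ eφ tr′ rest (Within-step (whisk u g v f₁ f₂) rest within) flat)
  walk⁺ φ eφ {a} {b} tr (whisk u {s} g v f₁ f₂ ◅ rest) (bp , _) flat
    | touch _ _ _ s₁ s₂ _ _ ea es eb with positive-heaviest-capped φ eφ g s₁ s₂ es (Bounded-infix u s v f₁ bp)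
  ...   | ϵ-left = Trace⁺-capped tr u v f₁ f₂ (trans ea (◅◅-identityʳ u)) eb rest

  -- The mirror image of Trace⁺, following the left wire prev φ of the η.
  data Trace⁻ {A B} {S : Path A B} {X Y} (φ : F₁ X Y) (a : Path A Y) (b : Path X B) {p : Path A B} :
              Cell S p → Set where
    trace⁻ : ∀ {p₀ p₁} (G : Cell S p₀) (v : Path Y B) e₁ e₂ {R : Cell p₁ p} →
             RightOf (a ◅◅ (prev φ ◅ ε)) (φ ◅ v) b R → p ≡ a ◅◅ (prev φ ◅ b) →
             Trace⁻ φ a b (G ◅◅ (whisk a (η φ) v e₁ e₂ ◅ R))

  Trace⁻-boundary : ∀ {A B} {S p : Path A B} {X Y} {φ : F₁ X Y} {a b} {c : Cell S p} →
                    Trace⁻ φ a b c → p ≡ a ◅◅ (prev φ ◅ b)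
  Trace⁻-boundary (trace⁻ _ _ _ _ _ eq) = eq

  Trace⁻-start : ∀ {A B} {S p₀ p₁ : Path A B} (G : Cell S p₀) {X Y} (φ : F₁ X Y) (u : Path A Y) (v : Path Y B)
                 e₁ e₂ → Trace⁻ φ u (φ ◅ v) (G ◅◅ (whisk {q = p₁} u (η φ) v e₁ e₂ ◅ ε))
  Trace⁻-start G φ u v e₁ e₂ = trace⁻ G v e₁ e₂ rnil e₂

  Trace⁻-right : ∀ {A B} {S p r : Path A B} {X Y} {φ : F₁ X Y} {a b} {c : Cell S p} → Trace⁻ φ a b c →
    ∀ {C D} (m : Path X C) {s t : Path C D} (g : F₂ s t) (v : Path D B) f₁ f₂ → b ≡ m ◅◅ (s ◅◅ v) →
    Up-to-≈ (Trace⁻ φ a (m ◅◅ (t ◅◅ v))) (c ◅◅ (whisk {q = r} (a ◅◅ (prev φ ◅ m)) g v f₁ f₂ ◅ ε))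
  Trace⁻-right {φ = φ} {a} (trace⁻ G v₀ e₁ e₂ {R} ro _) m {t = t} g v f₁ f₂ eb =
    _ , ≡⇒≈ (◅◅-assoc G (whisk a (η φ) v₀ e₁ e₂ ◅ R) (whisk (a ◅◅ (prev φ ◅ m)) g v f₁ f₂ ◅ ε)) ,
    trace⁻ G v₀ e₁ e₂ (RightOf-snoc ro _ m g v f₁ f₂ (sym (◅◅-assoc a (prev φ ◅ ε) m)) eb)
      (trans f₂ (◅◅-assoc a (prev φ ◅ m) (t ◅◅ v)))

  Trace⁻-left : ∀ {A B} {S p r : Path A B} {X Y} {φ : F₁ X Y} {a b} {c : Cell S p} → Trace⁻ φ a b c →
    ∀ {C D} (u : Path A C) {s t : Path C D} (g : F₂ s t) (m : Path D Y) f₁ f₂ → a ≡ u ◅◅ (s ◅◅ m) →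
    Up-to-≈ (Trace⁻ φ (u ◅◅ (t ◅◅ m)) b) (c ◅◅ (whisk {q = r} u g (m ◅◅ (prev φ ◅ b)) f₁ f₂ ◅ ε))
  Trace⁻-left {φ = φ} {b = b} (trace⁻ G v e₁ e₂ {R} ro _) u {s} {t} g m f₁ f₂ refl
    with RightOf-commute ro u (m ◅◅ (prev φ ◅ ε)) g (m ◅◅ (prev φ ◅ b)) f₁ f₂
           (◅◅-assoc₄ u s m (prev φ ◅ ε)) (sym (◅◅-assoc m (prev φ ◅ ε) b))
  ... | _ , R′ , h₁ , h₂ , ro′ , h =
    _ , equation ,
    trace⁻ (G ◅◅ (x′ ◅ ε)) v k₃ k₄
      (subst (λ w → RightOf w (φ ◅ v) b R′) (sym (◅◅-assoc₄ u t m (prev φ ◅ ε))) ro′)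
      (trans f₂ (sym (◅◅-assoc₄ u t m (prev φ ◅ b))))
    where
      open ≈-Reasoning
      reassoc = ◅◅-assoc m (prev φ ◅ ε) (φ ◅ v)
      k₇ = trans h₁ (cong (λ z → u ◅◅ (s ◅◅ z)) reassoc)
      k₈ = trans h₂ (cong (λ z → u ◅◅ (t ◅◅ z)) reassoc)
      k₁ = trans e₁ (◅◅-assoc₄ u s m v)
      k₃ = sym (◅◅-assoc₄ u t m v)
      k₄ = trans k₈ (sym (◅◅-assoc₄ u t m (prev φ ◅ φ ◅ v)))
      cup = whisk (u ◅◅ (s ◅◅ m)) (η φ) v e₁ e₂
      cup′ = whisk (u ◅◅ (t ◅◅ m)) (η φ) v k₃ k₄
      x = whisk u g (m ◅◅ (prev φ ◅ b)) f₁ f₂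
      x₀ = whisk u g ((m ◅◅ (prev φ ◅ ε)) ◅◅ (φ ◅ v)) h₁ h₂
      x₃ = whisk u g (m ◅◅ (prev φ ◅ φ ◅ v)) k₇ k₈
      x′ = whisk u g (m ◅◅ v) k₁ refl
      equation = begin
        (G ◅◅ (cup ◅ R)) ◅◅ (x ◅ ε)     ≡⟨ ◅◅-assoc G (cup ◅ R) (x ◅ ε) ⟩
        G ◅◅ (cup ◅ (R ◅◅ (x ◅ ε)))     ≈⟨ ◅◅-congˡ G (◅◅-congˡ (cup ◅ ε) h) ⟩
        G ◅◅ (cup ◅ x₀ ◅ R′)            ≡⟨ cong (λ y → G ◅◅ (cup ◅ y ◅ R′)) (whisk-cong g refl reassoc h₁ h₂ k₇ k₈) ⟩
        G ◅◅ (cup ◅ x₃ ◅ R′)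
          ≈⟨ ◅◅-congˡ G (◅◅-congʳ R′ (≈-sym (exchange u g m (η φ) v k₁ refl k₃ k₄ e₁ e₂ k₇ k₈))) ⟩
        G ◅◅ (x′ ◅ cup′ ◅ R′)           ≡⟨ sym (◅◅-assoc G (x′ ◅ ε) (cup′ ◅ R′)) ⟩
        (G ◅◅ (x′ ◅ ε)) ◅◅ (cup′ ◅ R′)  ∎

  Trace⁻-capped : ∀ {A B} {S p r Q : Path A B} {X Y} {φ : F₁ X Y} {a b} {c : Cell S p} → Trace⁻ φ a b c →
    ∀ (u : Path A X) (v : Path X B) f₁ f₂ → a ≡ u ◅◅ (φ ◅ ε) → b ≡ v → (rest : Cell r Q) →
    Reducible (c ◅◅ (whisk u (ϵ φ) v f₁ f₂ ◅ rest))
  Trace⁻-capped {φ = φ} {a} (trace⁻ G v₀ e₁ e₂ {R} ro _) u v f₁ f₂ ea refl rest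
    with RightOf-commute ro u ε (ϵ φ) v f₁ f₂
           (trans (cong (_◅◅ (prev φ ◅ ε)) ea) (◅◅-assoc u (φ ◅ ε) (prev φ ◅ ε))) refl
  ... | _ , R′ , h₁ , h₂ , _ , h =
    Reducible-resp equation
      (zigzagʳ-reducible G φ a v₀ e₁ e₂ u (φ ◅ v₀) h₁ h₂ (R′ ◅◅ rest) ea refl)
    where
      open ≈-Reasoning
      cup = whisk a (η φ) v₀ e₁ e₂
      cap = whisk u (ϵ φ) v f₁ f₂
      cap′ = whisk u (ϵ φ) (φ ◅ v₀) h₁ h₂
      equation = begin
        (G ◅◅ (cup ◅ R)) ◅◅ (cap ◅ rest)       ≡⟨ ◅◅-assoc G (cup ◅ R) (cap ◅ rest) ⟩
        G ◅◅ (cup ◅ (R ◅◅ (cap ◅ rest)))       ≡⟨ cong (λ y → G ◅◅ (cup ◅ y)) (sym (◅◅-assoc R (cap ◅ ε) rest)) ⟩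
        G ◅◅ (cup ◅ ((R ◅◅ (cap ◅ ε)) ◅◅ rest)) ≈⟨ ◅◅-congˡ G (◅◅-congˡ (cup ◅ ε) (◅◅-congʳ rest h)) ⟩
        G ◅◅ (cup ◅ cap′ ◅ (R′ ◅◅ rest))       ∎

  walk⁻ : ∀ {A B} {S p Q : Path A B} {X Y} (φ : F₁ X Y) {k} → expo (prev φ) ≡ -[1+ k ] →
          ∀ {a b} {c : Cell S p} → Trace⁻ φ a b c →
          (rest : Cell p Q) → Within (suc k) rest → Flat Q → Reducible (c ◅◅ rest)
  walk⁻ φ eφ {a} {b} tr ε _ flat with trans (sym eφ) (All-at a (prev φ) b (Trace⁻-boundary tr) flat)
  ... | ()
  walk⁻ φ eφ {a} {b} tr (whisk u {s} g v f₁ f₂ ◅ rest) within flat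
    with wireView (prev φ) a b (whisk u g v f₁ f₂) (Trace⁻-boundary tr)
  ... | left _ _ m _ _ ea with Trace⁻-left tr u g m f₁ f₂ ea
  ...   | _ , h , tr′ =
    Reducible-extend h rest (walk⁻ φ eφ tr′ rest (Within-step (whisk u g v f₁ f₂) rest within) flat)
  walk⁻ φ eφ {a} {b} tr (whisk u {s} g v f₁ f₂ ◅ rest) within flat
    | right m _ _ _ _ eb with Trace⁻-right tr m g v f₁ f₂ eb
  ...   | _ , h , tr′ =
    Reducible-extend h rest (walk⁻ φ eφ tr′ rest (Within-step (whisk u g v f₁ f₂) rest within) flat)
  walk⁻ φ eφ {a} {b} tr (whisk u {s} g v f₁ f₂ ◅ rest) (bp , _) flat
    | touch _ _ _ s₁ s₂ _ _ ea es eb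
    with negative-heaviest-capped φ refl eφ g s₁ s₂ es (Bounded-infix u s v f₁ bp)
  ...   | ϵ-right = Trace⁻-capped tr u v f₁ f₂ ea eb rest

  η-reducible : ∀ {A B} {S p₀ p₁ Q : Path A B} (G : Cell S p₀) {X Y} (φ : F₁ X Y) (u : Path A Y) (v : Path Y B)
                e₁ e₂ (c : Cell p₁ Q) → Within (degree (η φ)) c → Flat Q →
                Reducible (G ◅◅ (whisk u (η φ) v e₁ e₂ ◅ c))
  η-reducible G φ u v e₁ e₂ c within flat = Reducible-resp (≡⇒≈ (sym (◅◅-assoc G (cup ◅ ε) c))) walk
    where
      cup = whisk u (η φ) v e₁ e₂
      walk : Reducible ((G ◅◅ (cup ◅ ε)) ◅◅ c)
      walk with heavier-wire φ
      ... | right-wire n eφ deg =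
        walk⁺ φ eφ (Trace⁺-start G φ u v e₁ e₂) c (subst (λ D → Within D c) deg within) flat
      ... | left-wire k eφ deg =
        walk⁻ φ eφ (Trace⁻-start G φ u v e₁ e₂) c (subst (λ D → Within D c) deg within) flat

  reducible-at-max-degree : ∀ D {A B} {S p Q : Path A B} (G : Cell S p) (c : Cell p Q) →
    Within D c → D ≤ maxDegree c → 1 ≤ D → Flat Q → Reducible (G ◅◅ c)
  reducible-at-max-degree D G ε _ D≤0 1≤D _ = ⊥-elim (<⇒≱ 1≤D D≤0)
  reducible-at-max-degree D G (x ◅ c) within D≤ 1≤D flat with stepDegree x ℕ.≟ D
  reducible-at-max-degree D G (whisk u (η φ) v e₁ e₂ ◅ c) within D≤ 1≤D flat | yes refl =
    η-reducible G φ u v e₁ e₂ c (Within-step (whisk u (η φ) v e₁ e₂) c within) flat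
  reducible-at-max-degree _ G (whisk _ (lift _) _ _ _ ◅ c) _ _ () _ | yes refl
  reducible-at-max-degree _ G (whisk _ (ϵ _) _ _ _ ◅ c) _ _ () _ | yes refl
  reducible-at-max-degree D G (x ◅ c) within D≤ 1≤D flat | no x≢D =
    Reducible-resp (≡⇒≈ (sym (◅◅-assoc G (x ◅ ε) c)))
      (reducible-at-max-degree D (G ◅◅ (x ◅ ε)) c (Within-step x c within) D≤rest 1≤D flat)
    where
      x<D = ℕ.≤∧≢⇒< (m⊔n≤o⇒m≤o _ _ (proj₂ within)) x≢D
      D≤rest = ≤⊔∧<⇒≤ʳ D≤ x<D

  Contains-degree : ∀ {D A B} {p q : Path A B} {c : Cell p q} →
                    Contains IsUnitOrCounit c → Within D c → 1 ≤ D
  Contains-degree (here u v e₁ e₂ c (is-η φ)) (_ , h) = ≤-trans (1≤degree-η φ) (m⊔n≤o⇒m≤o _ _ h)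
  -- ϵ φ consumes the two wires that η φ creates.
  Contains-degree (here u v e₁ e₂ c (is-ϵ φ)) (bp , _) with Bounded-infix u (φ ◅ prev φ ◅ ε) v e₁ bp
  ... | ↦ φ≤ ◅ ↦ prev-φ≤ ◅ ε = ≤-trans (1≤degree-η φ) (⊔-lub prev-φ≤ φ≤)
  Contains-degree (there x {c} has) within = Contains-degree has (Within-step x c within)

mainTheorem1 : (E : Polygraph2) →
    let open Polygraph2 E
        open Construction E
    in ∀ {A B : E₀} (fs : Star (Star E₁) A B) (gs : Star (Star E₁) A B)
         (α : Cell (tensor0 fs) (tensor0 gs)) →
       IsNormalForm α → ¬ Contains IsUnitOrCounit α
mainTheorem1 E fs gs α normal hasCap =
  uncurry normal
    (reducible-at-max-degree (maxDegree α) ε α within ≤-refl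
      (Contains-degree hasCap within) (tensor0-flat gs))
  where
    open NormalForms E
    within : Within (maxDegree α) α
    within = Flat⇒Bounded (tensor0-flat fs) , ≤-refl
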